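{- Let $k\ge 3$, $\tau\in\mathcal{S}_k$ with $\tau(k-1)=k-1$, $\tau(k)=k$, and let $F$ be a forest on $[n]$. Applying the antishuffle operation to a special vertex $v$ of $F$ preserves the set of special vertices of $F$. Moreover, any vertex of $F$ that is not special retains its original label.
   Context: Forests on $[n]$ are unordered rooted forests with vertices labeled bijectively by $[n]$. An instance of a pattern $\rho\in\mathcal{S}_j$ is a sequence of vertices $v_1,\dots,v_j$ with $v_a$ a strict ancestor of $v_b$ for $a<b$ and labels in the same relative order as $\rho$; $v_j$ is its endpoint. Let $\bar\tau\in\mathcal{S}_{k-1}$ be given by $\bar\tau(i)=\tau(i)$ for $1\le i\le k-2$ and $\bar\tau(k-1)=k-1$. A vertex is special if it is the endpoint of some instance of $\bar\tau$. For a special vertex $v$, let $L$ be the label set of the subtree rooted at $v$ and let $y$ be the smallest element of $L$ such that $v$ would still be special if $v$ were labeled $y$ (with all other labels unchanged). To antishuffle $v$: label $v$ with $y$ and relabel the strict descendants of $v$ with $L\setminus\{y\}$ so that the relative order of their labels is preserved; all other vertices keep their labels. -}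

module Defs where

open import Data.Nat using (ℕ; zero; suc; _∸_) renaming (_<_ to _<ℕ_; _≤_ to _≤ℕ_)
open import Data.Nat.Properties using (m∸n≤m)
open import Data.Fin using (Fin; toℕ; inject≤; _≟_; _<_; _≤_)
open import Data.Fin.Permutation using (Permutation′; _⟨$⟩ʳ_)
open import Data.Maybe using (Maybe; just)
open import Data.Product using (Σ; ∃; _×_)
open import Relation.Binary.PropositionalEquality using (_≡_)
open import Relation.Nullary using (¬_; yes; no)

-- Unlabeled rooted forest on vertex set Fin n, given by a parent map
-- (nothing = root), required to be acyclic.
data Anc {n : ℕ} (parent : Fin n → Maybe (Fin n)) : Fin n → Fin n → Set where
  anc-parent : ∀ {u w} → parent w ≡ just u → Anc parent u w
  anc-step   : ∀ {u x w} → parent w ≡ just x → Anc parent u x → Anc parent u w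

record Forest (n : ℕ) : Set where
  field
    parent  : Fin n → Maybe (Fin n)
    acyclic : ∀ v → ¬ Anc parent v v

StrictAnc : ∀ {n} → Forest n → Fin n → Fin n → Set
StrictAnc F = Anc (Forest.parent F)

-- Labelings are maps Fin n → Fin n (vertex ↦ label, 0-indexed labels).
Labeling : ℕ → Set
Labeling n = Fin n → Fin n

-- A pattern of length j is given by its values ρ : Fin j → ℕ (only their
-- relative order matters).  An instance of ρ with endpoint v:
record Instance {n j : ℕ} (F : Forest n) (lab : Labeling n)
                (ρ : Fin j → ℕ) (v : Fin n) : Set where
  field
    vs       : Fin j → Fin n
    chain    : ∀ a b → a < b → StrictAnc F (vs a) (vs b)
    order→   : ∀ a b → lab (vs a) < lab (vs b) → ρ a <ℕ ρ b
    order←   : ∀ a b → ρ a <ℕ ρ b → lab (vs a) < lab (vs b)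
    endpoint : Σ (Fin j) (λ a → toℕ a ≡ j ∸ 1 × vs a ≡ v)

-- τ̄ ∈ S_{k-1}: τ̄(i) = τ(i) for 1 ≤ i ≤ k-2, τ̄(k-1) = k-1  (here 0-indexed)
τbar : ∀ {k} → Permutation′ k → Fin (k ∸ 1) → ℕ
τbar {k} τ i with Data.Nat._<?_ (toℕ i) (k ∸ 2)
... | yes _ = toℕ (τ ⟨$⟩ʳ inject≤ i (m∸n≤m k 1))
... | no  _ = k ∸ 2

Special : ∀ {n k} → Forest n → Permutation′ k → Labeling n → Fin n → Set
Special F τ lab v = Instance F lab (τbar τ) v

relabel : ∀ {n} → Labeling n → Fin n → Fin n → Labeling n
relabel lab v y w with w ≟ v
... | yes _ = y
... | no  _ = lab w

InSubtree : ∀ {n} → Forest n → Fin n → Fin n → Set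
InSubtree F v w = w ≡ v Data.Sum.⊎ StrictAnc F v w
  where import Data.Sum

InL : ∀ {n} → Forest n → Labeling n → Fin n → Fin n → Set
InL F lab v y = ∃ λ w → InSubtree F v w × lab w ≡ y

IsAntishuffleLabel : ∀ {n k} → Forest n → Permutation′ k → Labeling n
                   → Fin n → Fin n → Set
IsAntishuffleLabel F τ lab v y =
  InL F lab v y × Special F τ (relabel lab v y) v ×
  (∀ z → InL F lab v z → Special F τ (relabel lab v z) v → y ≤ z)

-- lab' is the result of antishuffling v in (F, lab):
-- v gets label y, strict descendants of v get the labels L \ {y} with
-- their relative order preserved, all other vertices keep their labels.
-- (These conditions determine lab' uniquely.)
record IsAntishuffle {n k} (F : Forest n) (τ : Permutation′ k)
                     (lab : Labeling n) (v : Fin n) (lab' : Labeling n) : Set where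
  field
    y          : Fin n
    y-spec     : IsAntishuffleLabel F τ lab v y
    at-v       : lab' v ≡ y
    outside    : ∀ w → ¬ InSubtree F v w → lab' w ≡ lab w
    desc-in-L  : ∀ w → StrictAnc F v w → InL F lab v (lab' w)
    desc-not-y : ∀ w → StrictAnc F v w → ¬ lab' w ≡ y
    desc-order : ∀ w w' → StrictAnc F v w → StrictAnc F v w' →
                 (lab w < lab w' → lab' w < lab' w') × (lab' w < lab' w' → lab w < lab w')

-- Since τ fixes its last two values, τ̄ ends with its maximum: a vertex u is
-- special iff some ancestor chain realising the first k - 2 letters of τ̄ has
-- all its labels below the label of u.  Let y be the antishuffle label of v.
-- Rerouting the chain witnessing that v is special with label y shows that
-- every vertex of the subtree of v whose label is at least y is special, both
-- before and after the antishuffle.  On the other hand the antishuffle fixes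
-- every label below y: the strict descendants of v receive L ∖ {y} in the
-- order of their old labels L ∖ {lab v}, and these two sets agree below
-- y ≤ lab v.  A vertex whose label is below y therefore sees the same labels
-- on its ancestors before and after, and vertices outside the subtree of v are
-- untouched together with all their ancestors.

module Submission where

open import Defs
open import Data.Nat using (ℕ; _∸_; _≤_)
open import Data.Fin using (Fin; toℕ)
open import Data.Fin.Permutation using (Permutation′; _⟨$⟩ʳ_)
open import Data.Product using (_×_)
open import Function.Definitions using (Injective)
open import Function.Bundles using (_⇔_)
open import Relation.Binary.PropositionalEquality using (_≡_)
open import Relation.Nullary using (¬_)

open import Data.Empty using (⊥-elim)
open import Data.Fin as Fin using (fromℕ<; inject≤) renaming (_<_ to _<ᶠ_; _≤_ to _≤ᶠ_)
open import Data.Fin.Properties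
  using (toℕ-injective; toℕ<n; toℕ≤pred[n]; toℕ-fromℕ<; toℕ-inject≤; pigeonhole; any?; punchOut-injective; <⇒notInjective)
open import Data.Maybe using (Maybe; just; nothing)
open import Data.Maybe.Properties using (just-injective)
open import Data.Nat as ℕ using (zero; suc; z≤n; s≤s; _<_; _<?_)
open import Data.Nat.Properties
  using (≤-refl; ≤-reflexive; ≤-trans; ≤-antisym; ≤⇒≯; <⇒≤; ≤-pred; ≮⇒≥; ≤∧≢⇒<; <-irrefl; <-asym; <-cmp; <-≤-trans; ≤-<-trans; n<1+n; m<n⇒m<1+n)
open import Data.Product using (Σ; ∃; _,_; proj₁; proj₂)
open import Data.Sum using (_⊎_; inj₁; inj₂)
open import Function using (_∘_)
open import Function.Bundles using (mk⇔; Injection)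
open import Function.Properties.Inverse using (↔⇒↣)
open import Relation.Binary.Definitions using (Decidable; tri<; tri≈; tri>)
open import Relation.Binary.PropositionalEquality using (_≢_; refl; sym; trans; cong; subst; subst₂)
open import Relation.Nullary using (Dec; yes; no; contradiction)
open import Relation.Nullary.Decidable using (map′; _⊎-dec_)

module _ {n : ℕ} {p : Fin n → Maybe (Fin n)} where

  Anc-trans : ∀ {a b c} → Anc p a b → Anc p b c → Anc p a c
  Anc-trans d (anc-parent e)  = anc-step e d
  Anc-trans d (anc-step e d′) = anc-step e (Anc-trans d d′)

  steps : ∀ {u w} → Anc p u w → ℕ
  steps (anc-parent _) = 1
  steps (anc-step _ d) = suc (steps d)

  -- the vertex t steps above w on the path d (meaningful for t ≤ steps d)
  vertexAt : ∀ {u w} → Anc p u w → ℕ → Fin n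
  vertexAt {w = w} d              zero    = w
  vertexAt {u = u} (anc-parent _) (suc _) = u
  vertexAt         (anc-step _ d) (suc t) = vertexAt d t

  vertexAt-anc-start : ∀ {u w} (d : Anc p u w) t → 0 < t → t ≤ steps d → Anc p (vertexAt d t) w
  vertexAt-anc-start (anc-parent e) (suc zero)    _ _         = anc-parent e
  vertexAt-anc-start (anc-step e d) (suc zero)    _ _         = anc-parent e
  vertexAt-anc-start (anc-step e d) (suc (suc t)) _ (s≤s t≤) =
    anc-step e (vertexAt-anc-start d (suc t) (s≤s z≤n) t≤)
  vertexAt-anc-start (anc-parent e) (suc (suc t)) _ (s≤s ())

  vertexAt-anc : ∀ {u w} (d : Anc p u w) {t t′} → t < t′ → t′ ≤ steps d →
                 Anc p (vertexAt d t′) (vertexAt d t)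
  vertexAt-anc d              {zero}  {t′}     t<t′       t′≤      = vertexAt-anc-start d t′ t<t′ t′≤
  vertexAt-anc (anc-parent e) {suc _} {suc _}  (s≤s ())     (s≤s z≤n)
  vertexAt-anc (anc-step e d) {suc _} {suc _}  (s≤s t<t′) (s≤s t′≤) = vertexAt-anc d t<t′ t′≤

module _ {n : ℕ} (F : Forest n) where
  open Forest F

  steps<n : ∀ {u w} (d : StrictAnc F u w) → steps d < n
  steps<n d with steps d <? n
  ... | yes lt = lt
  ... | no ≮n with pigeonhole (n<1+n n) (λ (i : Fin (suc n)) → vertexAt d (toℕ i))
  ...   | i , i′ , i<i′ , eq = contradiction
    (subst (λ z → Anc parent z (vertexAt d (toℕ i))) (sym eq)
      (vertexAt-anc d i<i′ (≤-trans (toℕ≤pred[n] i′) (≮⇒≥ ≮n))))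
    (acyclic _)

  private
    AncWithin : ℕ → Fin n → Fin n → Set
    AncWithin f u w = Σ (StrictAnc F u w) (λ d → steps d ≤ f)

    ancWithin? : ∀ f u w → Dec (AncWithin f u w)
    ancWithin? zero    u w = no λ { (anc-parent _ , ()) ; (anc-step _ _ , ()) }
    ancWithin? (suc f) u w with parent w in eq
    ... | nothing = no λ { (anc-parent e , _) → nothing≢just (trans (sym eq) e)
                         ; (anc-step e _ , _) → nothing≢just (trans (sym eq) e) }
      where
        nothing≢just : ∀ {x} → nothing ≢ just x
        nothing≢just ()
    ... | just x with x Fin.≟ u
    ...   | yes refl = yes (anc-parent eq , s≤s z≤n)
    ...   | no x≢u with ancWithin? f u x
    ...     | yes (d , d≤) = yes (anc-step eq d , s≤s d≤)
    ...     | no ¬d = no λ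
      { (anc-parent e , _)     → x≢u (just-injective (trans (sym eq) e))
      ; (anc-step e d , s≤s d≤) →
          ¬d (subst (AncWithin f u) (just-injective (trans (sym e) eq)) (d , d≤)) }

  strictAnc? : Decidable (StrictAnc F)
  strictAnc? u w = map′ proj₁ (λ d → d , <⇒≤ (steps<n d)) (ancWithin? n u w)

  inSubtree? : ∀ v w → Dec (InSubtree F v w)
  inSubtree? v w = w Fin.≟ v ⊎-dec strictAnc? v w

  module _ {v : Fin n} where

    anc-into-subtree : ∀ {a u} → StrictAnc F a v → InSubtree F v u → StrictAnc F a u
    anc-into-subtree d (inj₁ refl) = d
    anc-into-subtree d (inj₂ d′)   = Anc-trans d d′

    ancestor-∉-subtree : ∀ {a} → StrictAnc F a v → ¬ InSubtree F v a
    ancestor-∉-subtree d a∈ = acyclic _ (anc-into-subtree d a∈)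

    ∉-subtree-upward : ∀ {a w} → ¬ InSubtree F v w → StrictAnc F a w → ¬ InSubtree F v a
    ∉-subtree-upward w∉ d (inj₁ refl) = w∉ (inj₂ d)
    ∉-subtree-upward w∉ d (inj₂ d′)   = w∉ (inj₂ (Anc-trans d′ d))

relabel-at : ∀ {n} (l : Labeling n) v z → relabel l v z v ≡ z
relabel-at l v z with v Fin.≟ v
... | yes _  = refl
... | no v≢v = contradiction refl v≢v

relabel-elsewhere : ∀ {n} (l : Labeling n) {v z w} → w ≢ v → relabel l v z w ≡ l w
relabel-elsewhere l {v} {w = w} w≢v with w Fin.≟ v
... | yes w≡v = contradiction w≡v w≢v
... | no _    = refl

relabel-self : ∀ {n} (l : Labeling n) v w → relabel l v (l v) w ≡ l w
relabel-self l v w with w Fin.≟ v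
... | yes refl = refl
... | no _     = refl

injective⇒surjective : ∀ {n} {f : Fin n → Fin n} → Injective _≡_ _≡_ f → ∀ t → ∃ λ x → f x ≡ t
injective⇒surjective {suc n} {f} inj t with any? (λ x → f x Fin.≟ t)
... | yes hit = hit
... | no miss = ⊥-elim (<⇒notInjective (n<1+n n) f-avoiding-t-injective)
  where
    f-avoiding-t : Fin (suc n) → Fin n
    f-avoiding-t x = Fin.punchOut (λ t≡fx → miss (x , sym t≡fx))

    f-avoiding-t-injective : Injective _≡_ _≡_ f-avoiding-t
    f-avoiding-t-injective {x} {x′} eq =
      inj (punchOut-injective (λ e → miss (x , sym e)) (λ e → miss (x′ , sym e)) eq)

EndsWithMaximum : ∀ {j} → (Fin (suc j) → ℕ) → Set
EndsWithMaximum {j} ρ = ∀ a b → toℕ a ≢ j → toℕ b ≡ j → ρ a < ρ b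

τbar-endsWithMaximum : ∀ {j} (τ : Permutation′ (suc (suc j))) →
  (∀ i → toℕ i ≡ j → toℕ (τ ⟨$⟩ʳ i) ≡ j) →
  (∀ i → toℕ i ≡ suc j → toℕ (τ ⟨$⟩ʳ i) ≡ suc j) →
  EndsWithMaximum (τbar τ)
τbar-endsWithMaximum {j} τ fixes-j fixes-1+j a b a≢j b≡j =
  subst (τbar τ a <_) (sym τbar-b) τbar-a
  where
    misses : ∀ {c} i₀ → toℕ i₀ ≡ c → toℕ (τ ⟨$⟩ʳ i₀) ≡ c → ∀ i → toℕ i ≢ c → toℕ (τ ⟨$⟩ʳ i) ≢ c
    misses i₀ i₀≡c τi₀≡c i i≢c τi≡c =
      i≢c (trans (cong toℕ (Injection.injective (↔⇒↣ τ) (toℕ-injective (trans τi≡c (sym τi₀≡c))))) i₀≡c)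

    j<2+j : j < suc (suc j)
    j<2+j = m<n⇒m<1+n (n<1+n j)

    1+j<2+j : suc j < suc (suc j)
    1+j<2+j = n<1+n (suc j)

    τ-below-j : ∀ i → toℕ i < j → toℕ (τ ⟨$⟩ʳ i) < j
    τ-below-j i i<j = ≤∧≢⇒<
      (≤-pred (≤∧≢⇒< (≤-pred (toℕ<n (τ ⟨$⟩ʳ i)))
        (misses (fromℕ< 1+j<2+j) (toℕ-fromℕ< 1+j<2+j) (fixes-1+j _ (toℕ-fromℕ< 1+j<2+j)) i
          λ i≡1+j → <-asym i<j (subst (j <_) (sym i≡1+j) (n<1+n j)))))
      (misses (fromℕ< j<2+j) (toℕ-fromℕ< j<2+j) (fixes-j _ (toℕ-fromℕ< j<2+j)) i
        λ i≡j → <-irrefl i≡j i<j)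

    τbar-b : τbar τ b ≡ j
    τbar-b with toℕ b <? j
    ... | yes b<j = contradiction b≡j λ e → <-irrefl e b<j
    ... | no _    = refl

    τbar-a : τbar τ a < j
    τbar-a with toℕ a <? j
    ... | no a≮j  = contradiction (≤-antisym (toℕ≤pred[n] a) (≮⇒≥ a≮j)) a≢j
    ... | yes a<j = τ-below-j (inject≤ a _) (subst (_< j) (sym (toℕ-inject≤ a _)) a<j)

module _ {n j : ℕ} (F : Forest n) {ρ : Fin (suc j) → ℕ} where
  open Instance

  Instance-cong : ∀ {l l′ : Labeling n} {u} (I : Instance F l ρ u) →
                  (∀ a → l′ (vs I a) ≡ l (vs I a)) → Instance F l′ ρ u
  Instance-cong I l′≡l = record
    { vs       = vs I
    ; chain    = chain I
    ; order→   = λ a b lt → order→ I a b (subst₂ _<ᶠ_ (l′≡l a) (l′≡l b) lt)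
    ; order←   = λ a b lt → subst₂ _<ᶠ_ (sym (l′≡l a)) (sym (l′≡l b)) (order← I a b lt)
    ; endpoint = endpoint I
    }

  module _ {l : Labeling n} {u : Fin n} (I : Instance F l ρ u) where

    vs-endpoint : ∀ a → toℕ a ≡ j → vs I a ≡ u
    vs-endpoint a a≡j =
      let e , e≡j , vs-e = endpoint I in
      trans (cong (vs I) (toℕ-injective (trans a≡j (sym e≡j)))) vs-e

    vs-ancestor : ∀ a → toℕ a ≢ j → StrictAnc F (vs I a) u
    vs-ancestor a a≢j =
      let e , e≡j , vs-e = endpoint I in
      subst (StrictAnc F (vs I a)) vs-e
        (chain I a e (subst (toℕ a <_) (sym e≡j) (≤∧≢⇒< (toℕ≤pred[n] a) a≢j)))

    vs-∉-subtree : ∀ {v} → ¬ InSubtree F v u → ∀ a → ¬ InSubtree F v (vs I a)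
    vs-∉-subtree u∉ a with toℕ a ℕ.≟ j
    ... | yes a≡j = subst (λ z → ¬ InSubtree F _ z) (sym (vs-endpoint a a≡j)) u∉
    ... | no a≢j  = ∉-subtree-upward F u∉ (vs-ancestor a a≢j)

    module _ (max : EndsWithMaximum ρ) where

      vs-label-< : ∀ a → toℕ a ≢ j → l (vs I a) <ᶠ l u
      vs-label-< a a≢j =
        let e , e≡j , vs-e = endpoint I in
        subst (λ z → l (vs I a) <ᶠ l z) vs-e (order← I a e (max a e a≢j e≡j))

      vs-label-≤ : ∀ a → l (vs I a) ≤ᶠ l u
      vs-label-≤ a with toℕ a ℕ.≟ j
      ... | yes a≡j = ≤-reflexive (cong (toℕ ∘ l) (vs-endpoint a a≡j))
      ... | no a≢j  = <⇒≤ (vs-label-< a a≢j)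

  Instance-reroot : EndsWithMaximum ρ →
    ∀ {μ l : Labeling n} {v u} (J : Instance F μ ρ v) → InSubtree F v u →
    (∀ a → toℕ a ≢ j → l (vs J a) ≡ μ (vs J a)) → μ v ≤ᶠ l u → Instance F l ρ u
  Instance-reroot max {μ} {l} {v} {u} J u∈ l≡μ μv≤lu = record
    { vs       = vs′
    ; chain    = chain′
    ; order→   = order→′
    ; order←   = order←′
    ; endpoint = let e , e≡j , _ = endpoint J in e , e≡j , vs′-endpoint e e≡j
    }
    where
      replaceIf : ∀ {A : Set} → Dec A → Fin n → Fin n
      replaceIf (yes _) _ = u
      replaceIf (no _)  w = w

      vs′ : Fin (suc j) → Fin n
      vs′ a = replaceIf (toℕ a ℕ.≟ j) (vs J a)

      vs′-endpoint : ∀ a → toℕ a ≡ j → vs′ a ≡ u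
      vs′-endpoint a a≡j with toℕ a ℕ.≟ j
      ... | yes _   = refl
      ... | no a≢j  = contradiction a≡j a≢j

      below-u : ∀ a → toℕ a ≢ j → l (vs J a) <ᶠ l u
      below-u a a≢j = subst (_<ᶠ l u) (sym (l≡μ a a≢j)) (<-≤-trans (vs-label-< J max a a≢j) μv≤lu)

      chain′ : ∀ a b → a <ᶠ b → StrictAnc F (vs′ a) (vs′ b)
      chain′ a b a<b with toℕ a ℕ.≟ j | toℕ b ℕ.≟ j
      ... | yes a≡j | _       = contradiction (subst (_< toℕ b) a≡j a<b) (≤⇒≯ (toℕ≤pred[n] b))
      ... | no a≢j  | yes _   = anc-into-subtree F (vs-ancestor J a a≢j) u∈
      ... | no _    | no _    = chain J a b a<b

      order→′ : ∀ a b → l (vs′ a) <ᶠ l (vs′ b) → ρ a < ρ b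
      order→′ a b lt with toℕ a ℕ.≟ j | toℕ b ℕ.≟ j
      ... | yes _   | yes _   = contradiction lt (<-irrefl refl)
      ... | yes _   | no b≢j  = contradiction lt (<-asym (below-u b b≢j))
      ... | no a≢j  | yes b≡j = max a b a≢j b≡j
      ... | no a≢j  | no b≢j  = order→ J a b (subst₂ _<ᶠ_ (l≡μ a a≢j) (l≡μ b b≢j) lt)

      order←′ : ∀ a b → ρ a < ρ b → l (vs′ a) <ᶠ l (vs′ b)
      order←′ a b lt with toℕ a ℕ.≟ j | toℕ b ℕ.≟ j
      ... | yes a≡j | yes b≡j = contradiction lt (<-irrefl (cong ρ (toℕ-injective (trans a≡j (sym b≡j)))))
      ... | yes a≡j | no b≢j  = contradiction lt (<-asym (max b a b≢j a≡j))
      ... | no a≢j  | yes _   = below-u a a≢j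
      ... | no a≢j  | no b≢j  = subst₂ _<ᶠ_ (sym (l≡μ a a≢j)) (sym (l≡μ b b≢j)) (order← J a b lt)

module Antishuffle {n j : ℕ} (F : Forest n) (τ : Permutation′ (suc (suc j)))
  (max : EndsWithMaximum (τbar τ))
  {lab : Labeling n} (lab-injective : Injective _≡_ _≡_ lab)
  {v : Fin n} (v-special : Special F τ lab v)
  {lab′ : Labeling n} (antishuffle : IsAntishuffle F τ lab v lab′) where

  open IsAntishuffle antishuffle
  open Instance

  y≤lab-v : y ≤ᶠ lab v
  y≤lab-v = proj₂ (proj₂ y-spec) (lab v) (v , inj₁ refl , refl)
    (Instance-cong F v-special (relabel-self lab v ∘ vs v-special))

  special-from-y : ∀ (l : Labeling n) → (∀ w → ¬ InSubtree F v w → l w ≡ lab w) →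
                   ∀ u → InSubtree F v u → y ≤ᶠ l u → Special F τ l u
  special-from-y l l≡lab u u∈ y≤lu =
    Instance-reroot F max y-special u∈ l≡lab-on-chain (subst (_≤ᶠ l u) (sym (relabel-at lab v y)) y≤lu)
    where
      y-special : Special F τ (relabel lab v y) v
      y-special = proj₁ (proj₂ y-spec)

      l≡lab-on-chain : ∀ a → toℕ a ≢ j → l (vs y-special a) ≡ relabel lab v y (vs y-special a)
      l≡lab-on-chain a a≢j =
        trans (l≡lab _ vs-a∉) (sym (relabel-elsewhere lab (vs-a∉ ∘ inj₁)))
        where
          vs-a∉ : ¬ InSubtree F v (vs y-special a)
          vs-a∉ = ancestor-∉-subtree F (vs-ancestor F y-special a a≢j)

  lab′-in-L : ∀ b → InSubtree F v b → InL F lab v (lab′ b)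
  lab′-in-L b (inj₁ refl) = subst (InL F lab v) (sym at-v) (proj₁ y-spec)
  lab′-in-L b (inj₂ v<b)  = desc-in-L b v<b

  label-outside-∉-L : ∀ {a} → ¬ InSubtree F v a → ¬ InL F lab v (lab a)
  label-outside-∉-L a∉ (x , x∈ , lab-x≡lab-a) = a∉ (subst (InSubtree F v) (lab-injective lab-x≡lab-a) x∈)

  lab′-injective-on-subtree : ∀ {a b} → InSubtree F v a → InSubtree F v b → lab′ a ≡ lab′ b → a ≡ b
  lab′-injective-on-subtree (inj₁ refl) (inj₁ refl) _  = refl
  lab′-injective-on-subtree (inj₁ refl) (inj₂ v<b)  eq = ⊥-elim (desc-not-y _ v<b (trans (sym eq) at-v))
  lab′-injective-on-subtree (inj₂ v<a)  (inj₁ refl) eq = ⊥-elim (desc-not-y _ v<a (trans eq at-v))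
  lab′-injective-on-subtree {a} {b} (inj₂ v<a) (inj₂ v<b) eq with <-cmp (toℕ (lab a)) (toℕ (lab b))
  ... | tri< lt _ _ = ⊥-elim (<-irrefl (cong toℕ eq) (proj₁ (desc-order a b v<a v<b) lt))
  ... | tri≈ _ e _  = lab-injective (toℕ-injective e)
  ... | tri> _ _ gt = ⊥-elim (<-irrefl (cong toℕ (sym eq)) (proj₁ (desc-order b a v<b v<a) gt))

  lab′-injective : Injective _≡_ _≡_ lab′
  lab′-injective {a} {b} eq with inSubtree? F v a | inSubtree? F v b
  ... | no a∉  | no b∉  = lab-injective (trans (sym (outside a a∉)) (trans eq (outside b b∉)))
  ... | no a∉  | yes b∈ =
    ⊥-elim (label-outside-∉-L a∉ (subst (InL F lab v) (trans (sym eq) (outside a a∉)) (lab′-in-L b b∈)))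
  ... | yes a∈ | no b∉  =
    ⊥-elim (label-outside-∉-L b∉ (subst (InL F lab v) (trans eq (outside b b∉)) (lab′-in-L a a∈)))
  ... | yes a∈ | yes b∈ = lab′-injective-on-subtree a∈ b∈ eq

  LowLabelsFixed : ℕ → Set
  LowLabelsFixed t = ∀ w → StrictAnc F v w → toℕ (lab w) < t ⊎ toℕ (lab′ w) < t → lab′ w ≡ lab w

  -- Whoever carries the old label of w afterwards must be w itself.
  fixed-old-label : ∀ {t} → LowLabelsFixed t → t < toℕ y →
                    ∀ w → StrictAnc F v w → toℕ (lab w) ≡ t → lab′ w ≡ lab w
  fixed-old-label {t} fixed t<y w v<w lab-w≡t with <-cmp (toℕ (lab′ w)) (toℕ (lab w))
  ... | tri< lt _ _ = fixed w v<w (inj₂ (subst (toℕ (lab′ w) <_) lab-w≡t lt))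
  ... | tri≈ _ e _  = toℕ-injective e
  ... | tri> _ _ gt =
    let x , lab′-x≡lab-w = injective⇒surjective lab′-injective (lab w) in
    subst (λ z → lab′ z ≡ lab w) (preimage-is-w x lab′-x≡lab-w) lab′-x≡lab-w
    where
      preimage-is-w : ∀ x → lab′ x ≡ lab w → x ≡ w
      preimage-is-w x e with inSubtree? F v x
      ... | no x∉ = lab-injective (trans (sym (outside x x∉)) e)
      ... | yes (inj₁ refl) = ⊥-elim (<-irrefl (trans (sym lab-w≡t) (cong toℕ (trans (sym e) at-v))) t<y)
      ... | yes (inj₂ v<x) = lab-injective (trans (sym (fixed x v<x (inj₁ lab-x<t))) e)
        where
          lab-x<t : toℕ (lab x) < t
          lab-x<t = subst (toℕ (lab x) <_) lab-w≡t
            (proj₂ (desc-order x w v<x v<w) (subst (_<ᶠ lab′ w) (sym e) gt))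

  -- Whoever carried the new label of w before must be w itself.
  fixed-new-label : ∀ {t} → LowLabelsFixed t → t < toℕ y →
                    ∀ w → StrictAnc F v w → toℕ (lab′ w) ≡ t → lab′ w ≡ lab w
  fixed-new-label {t} fixed t<y w v<w lab′-w≡t with <-cmp (toℕ (lab w)) (toℕ (lab′ w))
  ... | tri< lt _ _ = fixed w v<w (inj₁ (subst (toℕ (lab w) <_) lab′-w≡t lt))
  ... | tri≈ _ e _  = toℕ-injective (sym e)
  ... | tri> _ _ gt =
    let x , x∈ , lab-x≡lab′-w = lab′-in-L w (inj₂ v<w) in
    sym (subst (λ z → lab z ≡ lab′ w) (preimage-is-w x x∈ lab-x≡lab′-w) lab-x≡lab′-w)
    where
      preimage-is-w : ∀ x → InSubtree F v x → lab x ≡ lab′ w → x ≡ w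
      preimage-is-w x (inj₁ refl) e =
        ⊥-elim (<-irrefl (sym (trans (cong toℕ e) lab′-w≡t)) (<-≤-trans t<y y≤lab-v))
      preimage-is-w x (inj₂ v<x)  e = lab′-injective (trans (fixed x v<x (inj₂ lab′-x<t)) e)
        where
          lab′-x<t : toℕ (lab′ x) < t
          lab′-x<t = subst (toℕ (lab′ x) <_) lab′-w≡t
            (proj₁ (desc-order x w v<x v<w) (subst (_<ᶠ lab w) (sym e) gt))

  low-labels-fixed : ∀ t → t ≤ toℕ y → LowLabelsFixed t
  low-labels-fixed zero    _   w _   (inj₁ ())
  low-labels-fixed zero    _   w _   (inj₂ ())
  low-labels-fixed (suc t) t<y w v<w below with below
  ... | inj₁ lab-w<1+t with toℕ (lab w) <? t
  ...   | yes lt = low-labels-fixed t (<⇒≤ t<y) w v<w (inj₁ lt)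
  ...   | no ≮t  = fixed-old-label (low-labels-fixed t (<⇒≤ t<y)) t<y w v<w
                     (≤-antisym (≤-pred lab-w<1+t) (≮⇒≥ ≮t))
  low-labels-fixed (suc t) t<y w v<w below | inj₂ lab′-w<1+t with toℕ (lab′ w) <? t
  ...   | yes lt = low-labels-fixed t (<⇒≤ t<y) w v<w (inj₂ lt)
  ...   | no ≮t  = fixed-new-label (low-labels-fixed t (<⇒≤ t<y)) t<y w v<w
                     (≤-antisym (≤-pred lab′-w<1+t) (≮⇒≥ ≮t))

  labels-below-y-fixed : ∀ w → toℕ (lab w) < toℕ y ⊎ toℕ (lab′ w) < toℕ y → lab′ w ≡ lab w
  labels-below-y-fixed w below with inSubtree? F v w
  ... | no w∉           = outside w w∉
  ... | yes (inj₂ v<w)  = low-labels-fixed (toℕ y) ≤-refl w v<w below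
  labels-below-y-fixed w (inj₁ lab-v<y)  | yes (inj₁ refl) = ⊥-elim (<-irrefl refl (≤-<-trans y≤lab-v lab-v<y))
  labels-below-y-fixed w (inj₂ lab′-v<y) | yes (inj₁ refl) = ⊥-elim (<-irrefl (cong toℕ at-v) lab′-v<y)

  nonspecial-fixed : ∀ u → ¬ Special F τ lab u → lab′ u ≡ lab u
  nonspecial-fixed u ¬special with toℕ (lab u) <? toℕ y | inSubtree? F v u
  ... | yes lab-u<y | _     = labels-below-y-fixed u (inj₁ lab-u<y)
  ... | no ≮y       | yes u∈ = contradiction (special-from-y lab (λ _ _ → refl) u u∈ (≮⇒≥ ≮y)) ¬special
  ... | no _        | no u∉  = outside u u∉

  special-preserved : ∀ u → Special F τ lab′ u ⇔ Special F τ lab u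
  special-preserved u with toℕ (lab u) <? toℕ y | inSubtree? F v u
  ... | yes lab-u<y | _ = mk⇔
    (λ I → Instance-cong F I λ a →
      sym (labels-below-y-fixed (vs I a) (inj₂ (≤-<-trans (vs-label-≤ F I max a) lab′-u<y))))
    (λ I → Instance-cong F I λ a →
      labels-below-y-fixed (vs I a) (inj₁ (≤-<-trans (vs-label-≤ F I max a) lab-u<y)))
    where
      lab′-u<y : toℕ (lab′ u) < toℕ y
      lab′-u<y = subst (λ z → toℕ z < toℕ y) (sym (labels-below-y-fixed u (inj₁ lab-u<y))) lab-u<y
  ... | no ≮y | yes u∈ = mk⇔
    (λ _ → special-from-y lab (λ _ _ → refl) u u∈ (≮⇒≥ ≮y))
    (λ _ → special-from-y lab′ outside u u∈ y≤lab′-u)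
    where
      y≤lab′-u : y ≤ᶠ lab′ u
      y≤lab′-u with toℕ (lab′ u) <? toℕ y
      ... | yes lt = contradiction (subst (λ z → toℕ z < toℕ y) (labels-below-y-fixed u (inj₂ lt)) lt) ≮y
      ... | no ≮y′ = ≮⇒≥ ≮y′
  ... | no _ | no u∉ = mk⇔
    (λ I → Instance-cong F I λ a → sym (outside _ (vs-∉-subtree F I u∉ a)))
    (λ I → Instance-cong F I λ a → outside _ (vs-∉-subtree F I u∉ a))

lemma4p4 : (k : ℕ) → 3 ≤ k → (τ : Permutation′ k) →
    (∀ i → toℕ i ≡ k ∸ 2 → toℕ (τ ⟨$⟩ʳ i) ≡ k ∸ 2) →
    (∀ i → toℕ i ≡ k ∸ 1 → toℕ (τ ⟨$⟩ʳ i) ≡ k ∸ 1) →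
    (n : ℕ) (F : Forest n) (lab : Labeling n) → Injective _≡_ _≡_ lab →
    (v : Fin n) → Special F τ lab v →
    (lab' : Labeling n) → IsAntishuffle F τ lab v lab' →
    (∀ u → Special F τ lab' u ⇔ Special F τ lab u)
    × (∀ u → ¬ Special F τ lab u → lab' u ≡ lab u)
lemma4p4 .(suc (suc (suc _))) (s≤s (s≤s (s≤s _))) τ fixes-k-2 fixes-k-1
         n F lab lab-injective v v-special lab′ antishuffle =
  special-preserved , nonspecial-fixed
  where
    open Antishuffle F τ (τbar-endsWithMaximum τ fixes-k-2 fixes-k-1) lab-injective v-special antishuffle
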